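{- For all integers $n\ge1$ and $k\ge1$, in $\mathbb Z[q]$ modulo $q^2-1$, $$\varepsilon(n,k)\equiv q^k\big(\varepsilon(n-1,k)+\varepsilon(n-1,k-1)\big)\quad\text{and}\quad \lambda(n,k)\equiv q^k\lambda(n-1,k)+\lambda(n-1,k-1),$$ and moreover $\varepsilon(n,0)=\lambda(n,0)=1$ for all $n\ge0$ and $\varepsilon(0,k)=\lambda(0,k)=0$ for $k>0$.
   Context: $e(n,k)$ (resp. $o(n,k)$) is the number of $k$-subsets of $\{1,\dots,n\}$ whose element sum is even (resp. odd), the empty set counting as even; both vanish for $k>n$. Losanitsch's triangle is defined by $L(0,j)=[j=0]$, $L(1,j)=[0\le j\le 1]$, $L(m,j)=0$ for $j<0$, and for $m\ge 2$ by $L(m,j)=L(m-2,j)+\binom{m-2}{j-1}+L(m-2,j-2)$ (with $\binom{a}{i}=0$ for $i<0$ or $i>a$); $\bar L(n,k)=\binom nk-L(n,k)$. Set $\varepsilon(n,k)=e(n,k)+q\,o(n,k)$ and $\lambda(n,k)=L(n,k)+q\,\bar L(n,k)$. -}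

module Defs where

open import Data.Nat as ℕ using (ℕ; zero; suc; _%_)
open import Data.Nat.Combinatorics using (_C_)
open import Data.Integer as ℤ using (ℤ; +_; -_)
open import Data.List using (List; []; _∷_; [_]; map; length; filter; upTo; replicate; _++_)
open import Data.Nat.ListAction using (sum)
open import Data.Product using (∃; _×_; _,_)
open import Relation.Nullary.Decidable using (_×-dec_)
open import Relation.Binary.PropositionalEquality using (_≡_)

-- Subsets of a list (each sublist = one subset, elements kept in order)

subsets : List ℕ → List (List ℕ)
subsets []       = [] ∷ []
subsets (x ∷ xs) = subsets xs ++ map (x ∷_) (subsets xs)

[1‥_] : ℕ → List ℕ
[1‥ n ] = map suc (upTo n)

e : ℕ → ℕ → ℕ
e n k = length (filter (λ s → (length s ℕ.≟ k) ×-dec (sum s % 2 ℕ.≟ 0)) (subsets [1‥ n ]))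

o : ℕ → ℕ → ℕ
o n k = length (filter (λ s → (length s ℕ.≟ k) ×-dec (sum s % 2 ℕ.≟ 1)) (subsets [1‥ n ]))

L : ℕ → ℕ → ℕ
L zero zero = 1
L zero (suc j) = 0
L (suc zero) zero = 1
L (suc zero) (suc zero) = 1
L (suc zero) (suc (suc j)) = 0
L (suc (suc m)) zero = L m zero                          -- binom(m,-1) = 0, L(m,-2) = 0
L (suc (suc m)) (suc zero) = L m 1 ℕ.+ (m C 0)            -- L(m,-1) = 0
L (suc (suc m)) (suc (suc j)) = L m (suc (suc j)) ℕ.+ (m C suc j) ℕ.+ L m j

Lbar : ℕ → ℕ → ℤ
Lbar n k = + (n C k) ℤ.- + (L n k)

-- Integer polynomials ℤ[q] as coefficient lists (lowest degree first)

Poly : Set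
Poly = List ℤ

coeff : Poly → ℕ → ℤ
coeff []       _       = + 0
coeff (a ∷ p)  zero    = a
coeff (a ∷ p)  (suc i) = coeff p i

infixl 6 _+ₚ_
infixl 7 _*ₚ_

_+ₚ_ : Poly → Poly → Poly
[]      +ₚ q       = q
(a ∷ p) +ₚ []      = a ∷ p
(a ∷ p) +ₚ (b ∷ q) = (a ℤ.+ b) ∷ (p +ₚ q)

-ₚ_ : Poly → Poly
-ₚ p = map -_ p

_*ₚ_ : Poly → Poly → Poly
[]      *ₚ q = []
(a ∷ p) *ₚ q = map (a ℤ.*_) q +ₚ (+ 0 ∷ (p *ₚ q))

qpow : ℕ → Poly
qpow k = replicate k (+ 0) ++ [ + 1 ]

constₚ : ℤ → Poly
constₚ c = [ c ]

q²-1 : Poly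
q²-1 = - (+ 1) ∷ + 0 ∷ + 1 ∷ []

-- equality of polynomials (coefficientwise; trailing zeros irrelevant)
infix 4 _≈ₚ_
_≈ₚ_ : Poly → Poly → Set
p ≈ₚ q = ∀ i → coeff p i ≡ coeff q i

infix 4 _≡_[mod-q²-1]
_≡_[mod-q²-1] : Poly → Poly → Set
p ≡ q [mod-q²-1] = ∃ λ h → p +ₚ (-ₚ q) ≈ₚ q²-1 *ₚ h

ε : ℕ → ℕ → Poly
ε n k = + e n k ∷ + o n k ∷ []

λ' : ℕ → ℕ → Poly
λ' n k = + L n k ∷ Lbar n k ∷ []

module Submission where

-- Reduction modulo q² - 1 is captured by the map  ρ : ℤ[q] → ℤ × ℤ  sending a
-- polynomial to (sum of its even-index coefficients, sum of its odd-index
-- coefficients).  Every p divides as  p = (q² - 1)·quot p + rem p  with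
-- rem p = ρ₁ p + ρ₂ p·q, so polynomials with the same ρ are congruent.  The map ρ
-- is additive, and multiplying by q^j swaps the two components j times ('twist j').
-- Both congruences thereby become identities between pairs of integers:
--  * (e(n,k), o(n,k)) counts k-subsets by parity of their sum.  A (k+1)-subset of
--    {1..n+1} is a shifted (k+1)-subset of {1..n}, or 1 together with a shifted
--    k-subset; either way the sum grows by k+1, giving
--    (e,o)(n+1,k+1) = twist (k+1) ((e,o)(n,k+1) + (e,o)(n,k)).
--  * Λ(n,k) = (L(n,k), L̄(n,k)) obeys the two-step recurrence
--    Λ(n+2,k+2) = Λ(n,k+2) + (C(n,k+1), C(n,k+1)) + Λ(n,k), from which
--    Λ(n+1,k+1) = twist (k+1) Λ(n,k+1) + Λ(n,k) follows by induction on n in steps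
--    of two, as twist is 2-periodic and fixes diagonal pairs.

open import Defs
open import Data.Nat as ℕ using (ℕ; zero; suc; _%_)
import Data.Nat.Properties as ℕP
open import Data.Nat.Combinatorics using (_C_; nCk+nC[k+1]≡[n+1]C[k+1])
open import Data.Nat.ListAction using (sum)
open import Data.Integer as ℤ using (ℤ; +_; -_)
import Data.Integer.Properties as ℤP
open import Data.Integer.Tactic.RingSolver using (solve-∀)
open import Data.Bool using (Bool; true; false; _∧_; if_then_else_)
open import Data.List using (List; []; _∷_; map; length; filter; _++_)
open import Data.List.Properties using (map-∘; map-++; map-upTo; length-map)
open import Data.Product using (_×_; _,_; proj₁; proj₂; swap)
open import Function using (_∘_)
open import Level using (Level)
open import Relation.Nullary using (Dec; yes; no; does)
open import Relation.Nullary.Decidable using (_×-dec_)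
open import Relation.Unary using (Pred; Decidable)
open import Relation.Binary.PropositionalEquality
open ≡-Reasoning

infixl 6 _⊕_

-- componentwise sum; with it ℤ × ℤ models ℤ[q]/(q² - 1) additively
_⊕_ : ℤ × ℤ → ℤ × ℤ → ℤ × ℤ
(a , b) ⊕ (c , d) = (a ℤ.+ c , b ℤ.+ d)

diag : ℤ → ℤ × ℤ
diag c = (c , c)

-- swap the components j times; by η for pairs, twist (2 + j) x ≡ twist j x holds
-- definitionally
twist : {A : Set} → ℕ → A × A → A × A
twist zero    x = x
twist (suc j) x = swap (twist j x)

twist-⊕ : ∀ j x y → twist j (x ⊕ y) ≡ twist j x ⊕ twist j y
twist-⊕ zero    x y = refl
twist-⊕ (suc j) x y = cong swap (twist-⊕ j x y)

twist-diag : {A : Set} → ∀ j (c : A) → twist j (c , c) ≡ (c , c)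
twist-diag zero    c = refl
twist-diag (suc j) c = cong swap (twist-diag j c)

-- Division by q² - 1

-- ρ p = (sum of even-index coefficients, sum of odd-index coefficients):
-- the remainder of p modulo q² - 1, as (constant term, coefficient of q)
ρ : Poly → ℤ × ℤ
ρ []      = (+ 0 , + 0)
ρ (a ∷ p) = (a ℤ.+ proj₂ (ρ p) , proj₁ (ρ p))

rem : Poly → Poly
rem p = proj₁ (ρ p) ∷ proj₂ (ρ p) ∷ []

-- from p = (q² - 1) h + x + y q one reads off
-- a + q p = (q² - 1) (y + q h) + (a + y) + x q
quot : Poly → Poly
quot []      = []
quot (a ∷ p) = proj₂ (ρ p) ∷ quot p

coeff-+ : ∀ p r i → coeff (p +ₚ r) i ≡ coeff p i ℤ.+ coeff r i
coeff-+ []      r       i       = sym (ℤP.+-identityˡ _)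
coeff-+ (a ∷ p) []      i       = sym (ℤP.+-identityʳ _)
coeff-+ (a ∷ p) (b ∷ r) zero    = refl
coeff-+ (a ∷ p) (b ∷ r) (suc i) = coeff-+ p r i

coeff-scale : ∀ c p i → coeff (map (c ℤ.*_) p) i ≡ c ℤ.* coeff p i
coeff-scale c []      i       = sym (ℤP.*-zeroʳ c)
coeff-scale c (a ∷ p) zero    = refl
coeff-scale c (a ∷ p) (suc i) = coeff-scale c p i

coeff-cons-* : ∀ a p r i → coeff ((a ∷ p) *ₚ r) i ≡ a ℤ.* coeff r i ℤ.+ coeff (+ 0 ∷ p *ₚ r) i
coeff-cons-* a p r i = trans (coeff-+ (map (a ℤ.*_) r) _ i) (cong (ℤ._+ _) (coeff-scale a r i))

coeff-q²-1 : ∀ h i → coeff (q²-1 *ₚ h) i ≡ coeff (+ 0 ∷ + 0 ∷ h) i ℤ.- coeff h i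
coeff-q²-1 h zero = trans (coeff-cons-* (- + 1) (+ 0 ∷ + 1 ∷ []) h 0) (lem (coeff h 0))
  where
  lem : ∀ x → - + 1 ℤ.* x ℤ.+ + 0 ≡ + 0 ℤ.- x
  lem = solve-∀
coeff-q²-1 h (suc zero) = begin
  coeff (q²-1 *ₚ h) 1
    ≡⟨ coeff-cons-* (- + 1) (+ 0 ∷ + 1 ∷ []) h 1 ⟩
  - + 1 ℤ.* coeff h 1 ℤ.+ coeff ((+ 0 ∷ + 1 ∷ []) *ₚ h) 0
    ≡⟨ cong (λ z → - + 1 ℤ.* coeff h 1 ℤ.+ z) (coeff-cons-* (+ 0) (+ 1 ∷ []) h 0) ⟩
  - + 1 ℤ.* coeff h 1 ℤ.+ (+ 0 ℤ.* coeff h 0 ℤ.+ + 0)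
    ≡⟨ lem (coeff h 1) (coeff h 0) ⟩
  + 0 ℤ.- coeff h 1 ∎
  where
  lem : ∀ x y → - + 1 ℤ.* x ℤ.+ (+ 0 ℤ.* y ℤ.+ + 0) ≡ + 0 ℤ.- x
  lem = solve-∀
coeff-q²-1 h (suc (suc i)) = begin
  coeff (q²-1 *ₚ h) (2 ℕ.+ i)
    ≡⟨ coeff-cons-* (- + 1) (+ 0 ∷ + 1 ∷ []) h (2 ℕ.+ i) ⟩
  - + 1 ℤ.* coeff h (2 ℕ.+ i) ℤ.+ coeff ((+ 0 ∷ + 1 ∷ []) *ₚ h) (suc i)
    ≡⟨ cong (λ z → x₂ ℤ.+ z) (coeff-cons-* (+ 0) (+ 1 ∷ []) h (suc i)) ⟩
  - + 1 ℤ.* coeff h (2 ℕ.+ i) ℤ.+ (+ 0 ℤ.* coeff h (suc i) ℤ.+ coeff ((+ 1 ∷ []) *ₚ h) i)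
    ≡⟨ cong (λ z → x₂ ℤ.+ (x₁ ℤ.+ z)) (coeff-cons-* (+ 1) [] h i) ⟩
  - + 1 ℤ.* coeff h (2 ℕ.+ i) ℤ.+ (+ 0 ℤ.* coeff h (suc i) ℤ.+ (+ 1 ℤ.* coeff h i ℤ.+ coeff (+ 0 ∷ []) i))
    ≡⟨ cong (λ z → x₂ ℤ.+ (x₁ ℤ.+ (+ 1 ℤ.* coeff h i ℤ.+ z))) (coeff-0∷[] i) ⟩
  - + 1 ℤ.* coeff h (2 ℕ.+ i) ℤ.+ (+ 0 ℤ.* coeff h (suc i) ℤ.+ (+ 1 ℤ.* coeff h i ℤ.+ + 0))
    ≡⟨ lem (coeff h (2 ℕ.+ i)) (coeff h (suc i)) (coeff h i) ⟩
  coeff h i ℤ.- coeff h (2 ℕ.+ i) ∎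
  where
  x₂ = - + 1 ℤ.* coeff h (2 ℕ.+ i)
  x₁ = + 0 ℤ.* coeff h (suc i)
  coeff-0∷[] : ∀ i → coeff (+ 0 ∷ []) i ≡ + 0
  coeff-0∷[] zero    = refl
  coeff-0∷[] (suc i) = refl
  lem : ∀ x y z → - + 1 ℤ.* x ℤ.+ (+ 0 ℤ.* y ℤ.+ (+ 1 ℤ.* z ℤ.+ + 0)) ≡ z ℤ.- x
  lem = solve-∀

division-coeff : ∀ p i →
  coeff p i ≡ (coeff (+ 0 ∷ + 0 ∷ quot p) i ℤ.- coeff (quot p) i) ℤ.+ coeff (rem p) i
division-coeff []      zero                = refl
division-coeff []      (suc zero)          = refl
division-coeff []      (suc (suc i))       = refl
division-coeff (a ∷ p) zero                = lem a (proj₂ (ρ p))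
  where
  lem : ∀ a y → a ≡ (+ 0 ℤ.- y) ℤ.+ (a ℤ.+ y)
  lem = solve-∀
division-coeff (a ∷ p) (suc zero)          = division-coeff p 0
division-coeff (a ∷ p) (suc (suc zero))    =
  trans (division-coeff p 1) (lem (coeff (quot p) 1) (proj₂ (ρ p)))
  where
  lem : ∀ h y → (+ 0 ℤ.- h) ℤ.+ y ≡ (y ℤ.- h) ℤ.+ + 0
  lem = solve-∀
division-coeff (a ∷ p) (suc (suc (suc i))) = division-coeff p (suc (suc i))

division : ∀ p → p ≈ₚ q²-1 *ₚ quot p +ₚ rem p
division p i = begin
  coeff p i
    ≡⟨ division-coeff p i ⟩
  (coeff (+ 0 ∷ + 0 ∷ quot p) i ℤ.- coeff (quot p) i) ℤ.+ coeff (rem p) i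
    ≡⟨ cong (ℤ._+ coeff (rem p) i) (sym (coeff-q²-1 (quot p) i)) ⟩
  coeff (q²-1 *ₚ quot p) i ℤ.+ coeff (rem p) i
    ≡⟨ sym (coeff-+ (q²-1 *ₚ quot p) (rem p) i) ⟩
  coeff (q²-1 *ₚ quot p +ₚ rem p) i ∎

ρ-+ : ∀ p r → ρ (p +ₚ r) ≡ ρ p ⊕ ρ r
ρ-+ []      r       = cong₂ _,_ (sym (ℤP.+-identityˡ _)) (sym (ℤP.+-identityˡ _))
ρ-+ (a ∷ p) []      = cong₂ _,_ (sym (ℤP.+-identityʳ _)) (sym (ℤP.+-identityʳ _))
ρ-+ (a ∷ p) (b ∷ r) =
  trans (cong (λ z → (a ℤ.+ b ℤ.+ proj₂ z , proj₁ z)) (ρ-+ p r))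
        (cong (_, _) (lem a b (proj₂ (ρ p)) (proj₂ (ρ r))))
  where
  lem : ∀ a b x y → a ℤ.+ b ℤ.+ (x ℤ.+ y) ≡ a ℤ.+ x ℤ.+ (b ℤ.+ y)
  lem = solve-∀

ρ-neg : ∀ p → ρ (-ₚ p) ≡ (- proj₁ (ρ p) , - proj₂ (ρ p))
ρ-neg []      = refl
ρ-neg (a ∷ p) =
  trans (cong (λ z → (- a ℤ.+ proj₂ z , proj₁ z)) (ρ-neg p))
        (cong (_, _) (sym (ℤP.neg-distrib-+ a (proj₂ (ρ p)))))

ρ-scale : ∀ c p → ρ (map (c ℤ.*_) p) ≡ (c ℤ.* proj₁ (ρ p) , c ℤ.* proj₂ (ρ p))
ρ-scale c []      = cong₂ _,_ (sym (ℤP.*-zeroʳ c)) (sym (ℤP.*-zeroʳ c))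
ρ-scale c (a ∷ p) =
  trans (cong (λ z → (c ℤ.* a ℤ.+ proj₂ z , proj₁ z)) (ρ-scale c p))
        (cong (_, _) (sym (ℤP.*-distribˡ-+ c a (proj₂ (ρ p)))))

-- q² ≡ 1, so multiplying by q^j swaps the two components j times
ρ-qpow : ∀ j p → ρ (qpow j *ₚ p) ≡ twist j (ρ p)
ρ-qpow zero    p = begin
  ρ (map (+ 1 ℤ.*_) p +ₚ (+ 0 ∷ []))          ≡⟨ ρ-+ (map (+ 1 ℤ.*_) p) (+ 0 ∷ []) ⟩
  ρ (map (+ 1 ℤ.*_) p) ⊕ (+ 0 , + 0)          ≡⟨ cong (_⊕ (+ 0 , + 0)) (ρ-scale (+ 1) p) ⟩
  (+ 1 ℤ.* x ℤ.+ + 0 , + 1 ℤ.* y ℤ.+ + 0)     ≡⟨ cong₂ _,_ (lem x) (lem y) ⟩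
  ρ p                                         ∎
  where
  x = proj₁ (ρ p)
  y = proj₂ (ρ p)
  lem : ∀ x → + 1 ℤ.* x ℤ.+ + 0 ≡ x
  lem = solve-∀
ρ-qpow (suc j) p = begin
  ρ (map (+ 0 ℤ.*_) p +ₚ (+ 0 ∷ Y))            ≡⟨ ρ-+ (map (+ 0 ℤ.*_) p) (+ 0 ∷ Y) ⟩
  ρ (map (+ 0 ℤ.*_) p) ⊕ ρ (+ 0 ∷ Y)           ≡⟨ cong (_⊕ ρ (+ 0 ∷ Y)) (ρ-scale (+ 0) p) ⟩
  (+ 0 ℤ.* x ℤ.+ (+ 0 ℤ.+ proj₂ (ρ Y)) , + 0 ℤ.* y ℤ.+ proj₁ (ρ Y))
    ≡⟨ cong₂ _,_ (lem₂ x (proj₂ (ρ Y))) (lem₁ y (proj₁ (ρ Y))) ⟩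
  swap (ρ Y)                                   ≡⟨ cong swap (ρ-qpow j p) ⟩
  twist (suc j) (ρ p)                          ∎
  where
  Y = qpow j *ₚ p
  x = proj₁ (ρ p)
  y = proj₂ (ρ p)
  lem₁ : ∀ x u → + 0 ℤ.* x ℤ.+ u ≡ u
  lem₁ = solve-∀
  lem₂ : ∀ x u → + 0 ℤ.* x ℤ.+ (+ 0 ℤ.+ u) ≡ u
  lem₂ = solve-∀

rem-zero : ∀ p → ρ p ≡ (+ 0 , + 0) → ∀ i → coeff (rem p) i ≡ + 0
rem-zero p eq zero          = cong proj₁ eq
rem-zero p eq (suc zero)    = cong proj₂ eq
rem-zero p eq (suc (suc i)) = refl

≡mod-from-ρ : ∀ A B → ρ A ≡ ρ B → A ≡ B [mod-q²-1]
≡mod-from-ρ A B same = quot D , λ i → begin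
  coeff D i                                          ≡⟨ division D i ⟩
  coeff (q²-1 *ₚ quot D +ₚ rem D) i                  ≡⟨ coeff-+ (q²-1 *ₚ quot D) (rem D) i ⟩
  coeff (q²-1 *ₚ quot D) i ℤ.+ coeff (rem D) i
    ≡⟨ cong (λ z → coeff (q²-1 *ₚ quot D) i ℤ.+ z) (rem-zero D ρD≡0 i) ⟩
  coeff (q²-1 *ₚ quot D) i ℤ.+ + 0                   ≡⟨ ℤP.+-identityʳ _ ⟩
  coeff (q²-1 *ₚ quot D) i                           ∎
  where
  D = A +ₚ (-ₚ B)
  ρD≡0 : ρ D ≡ (+ 0 , + 0)
  ρD≡0 = begin
    ρ (A +ₚ (-ₚ B))   ≡⟨ ρ-+ A (-ₚ B) ⟩
    ρ A ⊕ ρ (-ₚ B)    ≡⟨ cong₂ _⊕_ same (ρ-neg B) ⟩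
    ρ B ⊕ (- proj₁ (ρ B) , - proj₂ (ρ B))
      ≡⟨ cong₂ _,_ (ℤP.+-inverseʳ (proj₁ (ρ B))) (ℤP.+-inverseʳ (proj₂ (ρ B))) ⟩
    (+ 0 , + 0)       ∎

ρ-linear : ∀ a b → ρ (a ∷ b ∷ []) ≡ (a , b)
ρ-linear a b = cong₂ _,_ (ℤP.+-identityʳ a) (ℤP.+-identityʳ b)

count : {A : Set} → (A → Bool) → List A → ℕ
count p []       = 0
count p (x ∷ xs) = if p x then suc (count p xs) else count p xs

count-filter : {A : Set} {ℓ : Level} {P : Pred A ℓ} (P? : Decidable P) (xs : List A) →
               length (filter P? xs) ≡ count (λ x → does (P? x)) xs
count-filter P? []       = refl
count-filter P? (x ∷ xs) with does (P? x)
... | true  = cong suc (count-filter P? xs)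
... | false = count-filter P? xs

count-++ : {A : Set} (p : A → Bool) (xs ys : List A) →
           count p (xs ++ ys) ≡ count p xs ℕ.+ count p ys
count-++ p []       ys = refl
count-++ p (x ∷ xs) ys with p x
... | true  = cong suc (count-++ p xs ys)
... | false = count-++ p xs ys

count-map : {A B : Set} (p : B → Bool) (q : A → Bool) (f : A → B) →
            (∀ x → p (f x) ≡ q x) → ∀ xs → count p (map f xs) ≡ count q xs
count-map p q f eq []       = refl
count-map p q f eq (x ∷ xs) rewrite eq x with q x
... | true  = cong suc (count-map p q f eq xs)
... | false = count-map p q f eq xs

count-none : {A : Set} (xs : List A) → count (λ _ → false) xs ≡ 0
count-none []       = refl
count-none (x ∷ xs) = count-none xs

census : {A : Set} → (A → Bool × Bool) → List A → ℤ × ℤ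
census g xs = (+ count (proj₁ ∘ g) xs , + count (proj₂ ∘ g) xs)

census-++ : {A : Set} (g : A → Bool × Bool) (xs ys : List A) →
            census g (xs ++ ys) ≡ census g xs ⊕ census g ys
census-++ g xs ys = cong₂ _,_ (count-+ proj₁) (count-+ proj₂)
  where
  count-+ : (π : Bool × Bool → Bool) →
            + count (π ∘ g) (xs ++ ys) ≡ + count (π ∘ g) xs ℤ.+ + count (π ∘ g) ys
  count-+ π = trans (cong +_ (count-++ (π ∘ g) xs ys))
                    (ℤP.pos-+ (count (π ∘ g) xs) (count (π ∘ g) ys))

census-twist : {A : Set} (j : ℕ) (g : A → Bool × Bool) (xs : List A) →
               census (twist j ∘ g) xs ≡ twist j (census g xs)
census-twist zero    g xs = refl
census-twist (suc j) g xs = cong swap (census-twist j g xs)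

census-map : {A B : Set} (j : ℕ) (g : B → Bool × Bool) (h : A → Bool × Bool) (f : A → B) →
             (∀ x → g (f x) ≡ twist j (h x)) →
             ∀ xs → census g (map f xs) ≡ twist j (census h xs)
census-map j g h f eq xs = trans
  (cong₂ _,_ (cong +_ (count-map _ _ f (cong proj₁ ∘ eq) xs))
             (cong +_ (count-map _ _ f (cong proj₂ ∘ eq) xs)))
  (census-twist j h xs)

parity : ℕ → Bool × Bool
parity a = (does (a % 2 ℕ.≟ 0) , does (a % 2 ℕ.≟ 1))

parity-suc : ∀ a → parity (suc a) ≡ swap (parity a)
parity-suc zero          = refl
parity-suc (suc zero)    = refl
parity-suc (suc (suc a)) = parity-suc a

parity-+ : ∀ a m → parity (a ℕ.+ m) ≡ twist m (parity a)
parity-+ a zero    = cong parity (ℕP.+-identityʳ a)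
parity-+ a (suc m) = begin
  parity (a ℕ.+ suc m)          ≡⟨ cong parity (ℕP.+-suc a m) ⟩
  parity (suc (a ℕ.+ m))        ≡⟨ parity-suc (a ℕ.+ m) ⟩
  swap (parity (a ℕ.+ m))       ≡⟨ cong swap (parity-+ a m) ⟩
  twist (suc m) (parity a)      ∎

gate : Bool → Bool × Bool → Bool × Bool
gate b (x , y) = (b ∧ x , b ∧ y)

gate-twist : ∀ b j x → gate b (twist j x) ≡ twist j (gate b x)
gate-twist b zero    x = refl
gate-twist b (suc j) x = cong swap (gate-twist b j x)

classify : ℕ → List ℕ → Bool × Bool
classify k s = gate (does (length s ℕ.≟ k)) (parity (sum s))

gate-shift : ∀ m a k →
  gate (does (m ℕ.≟ k)) (parity (a ℕ.+ m)) ≡ twist k (gate (does (m ℕ.≟ k)) (parity a))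
gate-shift m a k = shift (m ℕ.≟ k)
  where
  shift : (d : Dec (m ≡ k)) →
          gate (does d) (parity (a ℕ.+ m)) ≡ twist k (gate (does d) (parity a))
  shift (yes refl) = trans (cong (gate true) (parity-+ a m)) (gate-twist true m (parity a))
  shift (no _)     = sym (twist-diag k false)

sum-map-suc : ∀ s → sum (map suc s) ≡ sum s ℕ.+ length s
sum-map-suc []      = refl
sum-map-suc (x ∷ s) = begin
  suc (x ℕ.+ sum (map suc s))         ≡⟨ cong (λ z → suc (x ℕ.+ z)) (sum-map-suc s) ⟩
  suc (x ℕ.+ (sum s ℕ.+ length s))    ≡⟨ cong suc (ℕP.+-assoc x (sum s) (length s)) ⟨
  suc (x ℕ.+ sum s ℕ.+ length s)      ≡⟨ ℕP.+-suc (x ℕ.+ sum s) (length s) ⟨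
  x ℕ.+ sum s ℕ.+ suc (length s)      ∎

classify-shift : ∀ k s → classify k (map suc s) ≡ twist k (classify k s)
classify-shift k s rewrite length-map suc s | sum-map-suc s = gate-shift (length s) (sum s) k

classify-insert-one : ∀ k s → classify (suc k) (1 ∷ map suc s) ≡ twist (suc k) (classify k s)
classify-insert-one k s rewrite length-map suc s | sum-map-suc s =
  trans (cong (gate (does (length s ℕ.≟ k))) (parity-suc (sum s ℕ.+ length s)))
        (cong swap (gate-shift (length s) (sum s) k))

-- The parity census of subsets: ε reduced modulo q² - 1

subsets-map : ∀ (f : ℕ → ℕ) xs → subsets (map f xs) ≡ map (map f) (subsets xs)
subsets-map f []       = refl
subsets-map f (x ∷ xs) = begin
  S′ ++ map (f x ∷_) S′
    ≡⟨ cong (λ T → T ++ map (f x ∷_) T) (subsets-map f xs) ⟩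
  map (map f) S ++ map (f x ∷_) (map (map f) S)
    ≡⟨ cong (map (map f) S ++_) (map-∘ S) ⟨
  map (map f) S ++ map (λ s → f x ∷ map f s) S
    ≡⟨ cong (map (map f) S ++_) (map-∘ S) ⟩
  map (map f) S ++ map (map f) (map (x ∷_) S)
    ≡⟨ map-++ (map f) S (map (x ∷_) S) ⟨
  map (map f) (S ++ map (x ∷_) S) ∎
  where
  S  = subsets xs
  S′ = subsets (map f xs)

range-suc : ∀ n → [1‥ suc n ] ≡ 1 ∷ map suc [1‥ n ]
range-suc n = cong (λ r → 1 ∷ map suc r) (sym (map-upTo suc n))

E : ℕ → ℕ → ℤ × ℤ
E n k = census (classify k) (subsets [1‥ n ])

eo≡E : ∀ n k → (+ e n k , + o n k) ≡ E n k
eo≡E n k =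
  cong₂ _,_ (cong +_ (count-filter (λ s → (length s ℕ.≟ k) ×-dec (sum s % 2 ℕ.≟ 0)) S))
            (cong +_ (count-filter (λ s → (length s ℕ.≟ k) ×-dec (sum s % 2 ℕ.≟ 1)) S))
  where
  S = subsets [1‥ n ]

ρ-ε : ∀ n k → ρ (ε n k) ≡ E n k
ρ-ε n k = trans (ρ-linear _ _) (eo≡E n k)

-- a (k+1)-subset of {1..n+1} is either a shifted (k+1)-subset of {1..n} or
-- 1 together with a shifted k-subset; in both cases the sum grows by k + 1
E-step : ∀ n k → E (suc n) (suc k) ≡ twist (suc k) (E n (suc k) ⊕ E n k)
E-step n k = begin
  census c (subsets [1‥ suc n ])
    ≡⟨ cong (census c ∘ subsets) (range-suc n) ⟩
  census c (subsets (map suc [1‥ n ]) ++ map (1 ∷_) (subsets (map suc [1‥ n ])))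
    ≡⟨ cong (λ T → census c (T ++ map (1 ∷_) T)) (subsets-map suc [1‥ n ]) ⟩
  census c (map (map suc) S ++ map (1 ∷_) (map (map suc) S))
    ≡⟨ cong (λ T → census c (map (map suc) S ++ T)) (map-∘ S) ⟨
  census c (map (map suc) S ++ map (λ s → 1 ∷ map suc s) S)
    ≡⟨ census-++ c (map (map suc) S) (map (λ s → 1 ∷ map suc s) S) ⟩
  census c (map (map suc) S) ⊕ census c (map (λ s → 1 ∷ map suc s) S)
    ≡⟨ cong₂ _⊕_ (census-map (suc k) c c (map suc) (classify-shift (suc k)) S)
                 (census-map (suc k) c (classify k) _ (classify-insert-one k) S) ⟩
  twist (suc k) (E n (suc k)) ⊕ twist (suc k) (E n k)
    ≡⟨ twist-⊕ (suc k) (E n (suc k)) (E n k) ⟨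
  twist (suc k) (E n (suc k) ⊕ E n k) ∎
  where
  c = classify (suc k)
  S = subsets [1‥ n ]

-- among the subsets of any list, only the empty one has size 0
E-size-zero : ∀ xs → census (classify 0) (subsets xs) ≡ (+ 1 , + 0)
E-size-zero []       = refl
E-size-zero (x ∷ xs) = begin
  census (classify 0) (S ++ map (x ∷_) S)
    ≡⟨ census-++ (classify 0) S (map (x ∷_) S) ⟩
  census (classify 0) S ⊕ census (classify 0) (map (x ∷_) S)
    ≡⟨ cong₂ _⊕_ (E-size-zero xs) (census-map 0 _ (λ _ → (false , false)) _ (λ _ → refl) S) ⟩
  (+ 1 , + 0) ⊕ census (λ _ → (false , false)) S
    ≡⟨ cong (λ m → (+ 1 , + 0) ⊕ (+ m , + m)) (count-none S) ⟩
  (+ 1 , + 0) ∎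
  where
  S = subsets xs

-- Losanitsch's triangle: λ reduced modulo q² - 1

Λ : ℕ → ℕ → ℤ × ℤ
Λ n k = (+ L n k , Lbar n k)

pascal : ∀ n k → + (suc n C suc k) ≡ + (n C k) ℤ.+ + (n C suc k)
pascal n k = trans (cong +_ (sym (nCk+nC[k+1]≡[n+1]C[k+1] n k))) (ℤP.pos-+ (n C k) (n C suc k))

L-zero : ∀ n → L n 0 ≡ 1
L-zero zero          = refl
L-zero (suc zero)    = refl
L-zero (suc (suc n)) = L-zero n

Λ-zero : ∀ n → Λ n 0 ≡ (+ 1 , + 0)
Λ-zero n = cong (λ l → (+ l , + 1 ℤ.- + l)) (L-zero n)

-- the defining recurrence of L, extended to the pair (L, L̄) via Pascal's rule
Λ-rec : ∀ n j → Λ (suc (suc n)) (suc (suc j)) ≡ Λ n (suc (suc j)) ⊕ diag (+ (n C suc j)) ⊕ Λ n j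
Λ-rec n j = cong₂ _,_ L-sum (begin
  + (suc (suc n) C suc (suc j)) ℤ.- + L (suc (suc n)) (suc (suc j))
    ≡⟨ cong₂ ℤ._-_ binomial L-sum ⟩
  (c₀ ℤ.+ c₁) ℤ.+ (c₁ ℤ.+ c₂) ℤ.- (l₂ ℤ.+ c₁ ℤ.+ l₀)
    ≡⟨ lem c₀ c₁ c₂ l₀ l₂ ⟩
  (c₂ ℤ.- l₂) ℤ.+ c₁ ℤ.+ (c₀ ℤ.- l₀) ∎)
  where
  c₀ = + (n C j)
  c₁ = + (n C suc j)
  c₂ = + (n C suc (suc j))
  l₀ = + L n j
  l₂ = + L n (suc (suc j))
  L-sum : + L (suc (suc n)) (suc (suc j)) ≡ l₂ ℤ.+ c₁ ℤ.+ l₀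
  L-sum = trans (ℤP.pos-+ (L n (suc (suc j)) ℕ.+ n C suc j) (L n j))
                (cong (ℤ._+ l₀) (ℤP.pos-+ (L n (suc (suc j))) (n C suc j)))
  binomial : + (suc (suc n) C suc (suc j)) ≡ (c₀ ℤ.+ c₁) ℤ.+ (c₁ ℤ.+ c₂)
  binomial = trans (pascal (suc n) (suc j)) (cong₂ ℤ._+_ (pascal n j) (pascal n (suc j)))
  lem : ∀ c₀ c₁ c₂ l₀ l₂ →
        (c₀ ℤ.+ c₁) ℤ.+ (c₁ ℤ.+ c₂) ℤ.- (l₂ ℤ.+ c₁ ℤ.+ l₀) ≡ (c₂ ℤ.- l₂) ℤ.+ c₁ ℤ.+ (c₀ ℤ.- l₀)
  lem = solve-∀

-- the same recurrence in size 1, where L(n,-1) = 0 and C(n,0) = 1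
Λ-rec₁ : ∀ n → Λ (suc (suc n)) 1 ≡ Λ n 1 ⊕ diag (+ 1)
Λ-rec₁ n = cong₂ _,_ L-sum (begin
  + (suc (suc n) C 1) ℤ.- + L (suc (suc n)) 1
    ≡⟨ cong₂ ℤ._-_ binomial L-sum ⟩
  + 1 ℤ.+ (+ 1 ℤ.+ c₁) ℤ.- (l₁ ℤ.+ + 1)
    ≡⟨ lem c₁ l₁ ⟩
  (c₁ ℤ.- l₁) ℤ.+ + 1 ∎)
  where
  c₁ = + (n C 1)
  l₁ = + L n 1
  L-sum : + L (suc (suc n)) 1 ≡ l₁ ℤ.+ + 1
  L-sum = ℤP.pos-+ (L n 1) 1
  binomial : + (suc (suc n) C 1) ≡ + 1 ℤ.+ (+ 1 ℤ.+ c₁)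
  binomial = trans (pascal (suc n) 0) (cong (λ z → + 1 ℤ.+ z) (pascal n 0))
  lem : ∀ c l → + 1 ℤ.+ (+ 1 ℤ.+ c) ℤ.- (l ℤ.+ + 1) ≡ (c ℤ.- l) ℤ.+ + 1
  lem = solve-∀

⊕-exchange : ∀ x y z → x ⊕ y ⊕ z ≡ x ⊕ z ⊕ y
⊕-exchange (x₁ , x₂) (y₁ , y₂) (z₁ , z₂) = cong₂ _,_ (lem x₁ y₁ z₁) (lem x₂ y₂ z₂)
  where
  lem : ∀ x y z → x ℤ.+ y ℤ.+ z ≡ x ℤ.+ z ℤ.+ y
  lem = solve-∀

⊕-regroup₅ : ∀ a b d u c → a ⊕ b ⊕ diag (u ℤ.+ c) ⊕ d ≡ (a ⊕ diag c ⊕ d) ⊕ (b ⊕ diag u)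
⊕-regroup₅ (a₁ , a₂) (b₁ , b₂) (d₁ , d₂) u c =
  cong₂ _,_ (lem a₁ b₁ d₁ u c) (lem a₂ b₂ d₂ u c)
  where
  lem : ∀ a b d u c → a ℤ.+ b ℤ.+ (u ℤ.+ c) ℤ.+ d ≡ (a ℤ.+ c ℤ.+ d) ℤ.+ (b ℤ.+ u)
  lem = solve-∀

⊕-regroup₆ : ∀ a b c d u v →
             a ⊕ b ⊕ diag (u ℤ.+ v) ⊕ (c ⊕ d) ≡ (a ⊕ diag v ⊕ c) ⊕ (b ⊕ diag u ⊕ d)
⊕-regroup₆ (a₁ , a₂) (b₁ , b₂) (c₁ , c₂) (d₁ , d₂) u v =
  cong₂ _,_ (lem a₁ b₁ c₁ d₁ u v) (lem a₂ b₂ c₂ d₂ u v)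
  where
  lem : ∀ a b c d u v →
        a ℤ.+ b ℤ.+ (u ℤ.+ v) ℤ.+ (c ℤ.+ d) ≡ (a ℤ.+ v ℤ.+ c) ℤ.+ (b ℤ.+ u ℤ.+ d)
  lem = solve-∀

twist-rec : ∀ j a c b → twist j (a ⊕ diag c ⊕ b) ≡ twist j a ⊕ diag c ⊕ twist j b
twist-rec j a c b = begin
  twist j (a ⊕ diag c ⊕ b)              ≡⟨ twist-⊕ j (a ⊕ diag c) b ⟩
  twist j (a ⊕ diag c) ⊕ twist j b      ≡⟨ cong (_⊕ twist j b) (twist-⊕ j a (diag c)) ⟩
  twist j a ⊕ twist j (diag c) ⊕ twist j b
    ≡⟨ cong (λ z → twist j a ⊕ z ⊕ twist j b) (twist-diag j c) ⟩
  twist j a ⊕ diag c ⊕ twist j b        ∎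

-- the remainder form of  λ(n+1,k+1) ≡ q^(k+1) λ(n,k+1) + λ(n,k)
LosanitschStep : ℕ → ℕ → Set
LosanitschStep n k = Λ (suc n) (suc k) ≡ twist (suc k) (Λ n (suc k)) ⊕ Λ n k

-- the inductive step for sizes ≥ 3: two instances at n give the instance at n + 2,
-- because twist (j + 3) = twist (j + 1) is additive and fixes diagonal pairs
Λ-step-lift : ∀ n j → LosanitschStep n (2 ℕ.+ j) → LosanitschStep n j →
              LosanitschStep (2 ℕ.+ n) (2 ℕ.+ j)
Λ-step-lift n j step₂ step₀ = begin
  Λ (3 ℕ.+ n) (3 ℕ.+ j)
    ≡⟨ Λ-rec (suc n) (suc j) ⟩
  Λ (suc n) (3 ℕ.+ j) ⊕ diag (+ (suc n C (2 ℕ.+ j))) ⊕ Λ (suc n) (suc j)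
    ≡⟨ cong₂ (λ x z → x ⊕ diag (+ (suc n C (2 ℕ.+ j))) ⊕ z) step₂ step₀ ⟩
  tw (Λ n (3 ℕ.+ j)) ⊕ Λ n (2 ℕ.+ j) ⊕ diag (+ (suc n C (2 ℕ.+ j))) ⊕ (tw (Λ n (suc j)) ⊕ Λ n j)
    ≡⟨ cong (λ y → tw (Λ n (3 ℕ.+ j)) ⊕ Λ n (2 ℕ.+ j) ⊕ diag y ⊕ (tw (Λ n (suc j)) ⊕ Λ n j))
            (pascal n (suc j)) ⟩
  tw (Λ n (3 ℕ.+ j)) ⊕ Λ n (2 ℕ.+ j) ⊕ diag (c₁ ℤ.+ c₂) ⊕ (tw (Λ n (suc j)) ⊕ Λ n j)
    ≡⟨ ⊕-regroup₆ (tw (Λ n (3 ℕ.+ j))) (Λ n (2 ℕ.+ j)) (tw (Λ n (suc j))) (Λ n j) c₁ c₂ ⟩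
  (tw (Λ n (3 ℕ.+ j)) ⊕ diag c₂ ⊕ tw (Λ n (suc j))) ⊕ (Λ n (2 ℕ.+ j) ⊕ diag c₁ ⊕ Λ n j)
    ≡⟨ cong (_⊕ (Λ n (2 ℕ.+ j) ⊕ diag c₁ ⊕ Λ n j)) (twist-rec (suc j) (Λ n (3 ℕ.+ j)) c₂ (Λ n (suc j))) ⟨
  tw (Λ n (3 ℕ.+ j) ⊕ diag c₂ ⊕ Λ n (suc j)) ⊕ (Λ n (2 ℕ.+ j) ⊕ diag c₁ ⊕ Λ n j)
    ≡⟨ cong₂ (λ x y → tw x ⊕ y) (Λ-rec n (suc j)) (Λ-rec n j) ⟨
  tw (Λ (2 ℕ.+ n) (3 ℕ.+ j)) ⊕ Λ (2 ℕ.+ n) (2 ℕ.+ j) ∎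
  where
  tw = twist (suc j)
  c₁ = + (n C suc j)
  c₂ = + (n C suc (suc j))

-- induction on n in steps of two; sizes 1 and 2 use the boundary recurrence Λ-rec₁
Λ-step : ∀ n k → LosanitschStep n k
Λ-step zero                zero          = refl
Λ-step zero                (suc k)       =
  cong (_⊕ Λ 0 (suc k)) (sym (twist-diag (suc (suc k)) (+ 0)))
Λ-step (suc zero)          zero          = refl
Λ-step (suc zero)          (suc zero)    = refl
Λ-step (suc zero)          (suc (suc k)) =
  cong (_⊕ Λ 1 (suc (suc k))) (sym (twist-diag (suc (suc (suc k))) (+ 0)))
Λ-step (suc (suc n))       zero          = begin
  Λ (3 ℕ.+ n) 1                                    ≡⟨ Λ-rec₁ (suc n) ⟩
  Λ (suc n) 1 ⊕ diag (+ 1)                         ≡⟨ cong (_⊕ diag (+ 1)) (Λ-step n 0) ⟩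
  swap (Λ n 1) ⊕ Λ n 0 ⊕ diag (+ 1)                ≡⟨ ⊕-exchange (swap (Λ n 1)) (Λ n 0) (diag (+ 1)) ⟩
  swap (Λ n 1 ⊕ diag (+ 1)) ⊕ Λ n 0                ≡⟨ cong (λ x → swap x ⊕ Λ n 0) (Λ-rec₁ n) ⟨
  swap (Λ (2 ℕ.+ n) 1) ⊕ Λ (2 ℕ.+ n) 0             ∎
Λ-step (suc (suc n))       (suc zero)    = begin
  Λ (3 ℕ.+ n) 2
    ≡⟨ Λ-rec (suc n) 0 ⟩
  Λ (suc n) 2 ⊕ diag (+ (suc n C 1)) ⊕ Λ (suc n) 0
    ≡⟨ cong₂ (λ x y → x ⊕ diag y ⊕ Λ (suc n) 0) (Λ-step n 1) (pascal n 0) ⟩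
  Λ n 2 ⊕ Λ n 1 ⊕ diag (+ 1 ℤ.+ + (n C 1)) ⊕ Λ (suc n) 0
    ≡⟨ cong (Λ n 2 ⊕ Λ n 1 ⊕ diag (+ 1 ℤ.+ + (n C 1)) ⊕_) (trans (Λ-zero (suc n)) (sym (Λ-zero n))) ⟩
  Λ n 2 ⊕ Λ n 1 ⊕ diag (+ 1 ℤ.+ + (n C 1)) ⊕ Λ n 0
    ≡⟨ ⊕-regroup₅ (Λ n 2) (Λ n 1) (Λ n 0) (+ 1) (+ (n C 1)) ⟩
  (Λ n 2 ⊕ diag (+ (n C 1)) ⊕ Λ n 0) ⊕ (Λ n 1 ⊕ diag (+ 1))
    ≡⟨ cong₂ _⊕_ (Λ-rec n 0) (Λ-rec₁ n) ⟨
  Λ (2 ℕ.+ n) 2 ⊕ Λ (2 ℕ.+ n) 1 ∎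
Λ-step (suc (suc n))       (suc (suc j)) = Λ-step-lift n j (Λ-step n (2 ℕ.+ j)) (Λ-step n j)

ε-recurrence : ∀ n k → ε (suc n) (suc k) ≡ qpow (suc k) *ₚ (ε n (suc k) +ₚ ε n k) [mod-q²-1]
ε-recurrence n k = ≡mod-from-ρ (ε (suc n) (suc k)) (qpow (suc k) *ₚ (ε n (suc k) +ₚ ε n k)) (begin
  ρ (ε (suc n) (suc k))                           ≡⟨ ρ-ε (suc n) (suc k) ⟩
  E (suc n) (suc k)                               ≡⟨ E-step n k ⟩
  twist (suc k) (E n (suc k) ⊕ E n k)
    ≡⟨ cong (twist (suc k)) (cong₂ _⊕_ (ρ-ε n (suc k)) (ρ-ε n k)) ⟨
  twist (suc k) (ρ (ε n (suc k)) ⊕ ρ (ε n k))     ≡⟨ cong (twist (suc k)) (ρ-+ (ε n (suc k)) (ε n k)) ⟨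
  twist (suc k) (ρ (ε n (suc k) +ₚ ε n k))        ≡⟨ ρ-qpow (suc k) (ε n (suc k) +ₚ ε n k) ⟨
  ρ (qpow (suc k) *ₚ (ε n (suc k) +ₚ ε n k))      ∎)

λ-recurrence : ∀ n k → λ' (suc n) (suc k) ≡ qpow (suc k) *ₚ λ' n (suc k) +ₚ λ' n k [mod-q²-1]
λ-recurrence n k = ≡mod-from-ρ (λ' (suc n) (suc k)) (qpow (suc k) *ₚ λ' n (suc k) +ₚ λ' n k) (begin
  ρ (λ' (suc n) (suc k))                              ≡⟨ ρ-linear _ _ ⟩
  Λ (suc n) (suc k)                                   ≡⟨ Λ-step n k ⟩
  twist (suc k) (Λ n (suc k)) ⊕ Λ n k
    ≡⟨ cong₂ _⊕_ (cong (twist (suc k)) (ρ-linear _ _)) (ρ-linear _ _) ⟨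
  twist (suc k) (ρ (λ' n (suc k))) ⊕ ρ (λ' n k)
    ≡⟨ cong (_⊕ ρ (λ' n k)) (ρ-qpow (suc k) (λ' n (suc k))) ⟨
  ρ (qpow (suc k) *ₚ λ' n (suc k)) ⊕ ρ (λ' n k)      ≡⟨ ρ-+ (qpow (suc k) *ₚ λ' n (suc k)) (λ' n k) ⟨
  ρ (qpow (suc k) *ₚ λ' n (suc k) +ₚ λ' n k)         ∎)

linear≈const : ∀ {a b c} → (a , b) ≡ (c , + 0) → a ∷ b ∷ [] ≈ₚ constₚ c
linear≈const eq zero          = cong proj₁ eq
linear≈const eq (suc zero)    = cong proj₂ eq
linear≈const eq (suc (suc i)) = refl

proposition4p3 :
    (∀ n k → ε (suc n) (suc k) ≡ qpow (suc k) *ₚ (ε n (suc k) +ₚ ε n k) [mod-q²-1])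
    × (∀ n k → λ' (suc n) (suc k) ≡ qpow (suc k) *ₚ λ' n (suc k) +ₚ λ' n k [mod-q²-1])
    × (∀ n → ε n 0 ≈ₚ constₚ (+ 1))
    × (∀ n → λ' n 0 ≈ₚ constₚ (+ 1))
    × (∀ k → ε 0 (suc k) ≈ₚ constₚ (+ 0))
    × (∀ k → λ' 0 (suc k) ≈ₚ constₚ (+ 0))
proposition4p3 =
    ε-recurrence
  , λ-recurrence
  , (λ n → linear≈const (trans (eo≡E n 0) (E-size-zero [1‥ n ])))
  , (λ n → linear≈const (Λ-zero n))
  , (λ k → linear≈const refl)
  , (λ k → linear≈const refl)
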